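{- Let $G_0,G_1\in\mathbb{Z}$ with $\gcd(G_0,G_1)=1$, and let $(G_n)_{n\ge0}$ satisfy $G_n=G_{n-1}+G_{n-2}$ for $n\ge2$. If $k$ is an odd positive integer, then no prime $p$ with $p\equiv 3,7,13,17\pmod{20}$ divides $\mathcal{G}_{G_0,G_1}(k)$.
   Context: $\mathcal{G}_{G_0,G_1}(k)$ is the greatest common divisor of all integers $\sum_{i=0}^{k-1}G_{n+i}$, $n\ge1$. -}

module Defs where

open import Data.Nat using (ℕ; zero; suc; _≤_)
open import Data.Integer using (ℤ; +_; _+_)
open import Data.Integer.Divisibility using (_∣_)
open import Data.Product using (_×_)

windowSum : (ℕ → ℤ) → ℕ → ℕ → ℤ
windowSum G n zero    = + 0
windowSum G n (suc k) = G n + windowSum G (suc n) k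

IsWindowSumGCD : (ℕ → ℤ) → ℕ → ℕ → Set
IsWindowSumGCD G k d =
  (∀ n → 1 ≤ n → (+ d) ∣ windowSum G n k) ×
  (∀ (c : ℤ) → (∀ n → 1 ≤ n → c ∣ windowSum G n k) → c ∣ (+ d))

{-# OPTIONS --safe #-}

-- Let S_n be the sum of k consecutive terms starting at G_n. It is again a linear function of
-- (G₀, G₁): (S₁, S₂) is the image of (G₀, G₁) under an integer 2×2 matrix whose determinant is
-- the Lucas number L_k when k is odd (Cassini's identity), so multiplying by the adjugate shows
-- that every common divisor of S₁ and S₂ divides L_k G₀ and L_k G₁, hence L_k as gcd(G₀, G₁) = 1.
-- For odd k, L_k² − 5 F_k² = −4, so a prime p ∣ L_k makes 5 a square modulo p. That is
-- impossible when p ≡ ±3, ±7 (mod 20): Thue's lemma gives a, b, not both 0, with |a|, |b| < √p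
-- and b² ≡ 5a² (mod p), so, as b² < p, 5a² = b² + m p with 0 ≤ m < 5. Then m = 0 contradicts the
-- irrationality of √5, m = 3 forces 3 ∣ p (modulo 9), hence p = 3, and then |a| ≤ 1 makes
-- 5a² = b² + 9 impossible; m = 1, 2, 4 are excluded modulo 20.

module Submission where

open import Defs
open import Data.Nat as ℕ using (ℕ; zero; suc; _≤_; _<_; _%_; _/_; s≤s; z≤n; NonZero)
open import Data.Nat.Primality using (Prime; euclidsLemma; prime⇒nonZero)
open import Data.Product using (∃₂; _×_; _,_; proj₁; proj₂; uncurry)
open import Data.Sum using (_⊎_; inj₁; inj₂; reduce; [_,_]′)
open import Relation.Binary.PropositionalEquality
open import Relation.Nullary using (¬_; contradiction)

module OverNaturals where

  open import Data.Nat
  open import Data.Nat.Properties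
  open import Data.Nat.DivMod using (%-distribˡ-+; %-distribˡ-*; m%n%n≡m%n; m%n<n; m∣n⇒o%n%m≡o%m)
  open import Data.Nat.Divisibility using (_∣_; _∣?_; divides; m%n≡0⇒n∣m; ∣⇒≤)
  open import Data.Nat.Primality using (prime?; prime⇒irreducible; ¬prime[1])
  open import Data.Nat.Induction using (<-wellFounded)
  open import Data.Nat.Tactic.RingSolver using (solve-∀)
  open import Induction.WellFounded using (Acc; acc; WfRec)
  open import Data.Product using (∃)
  open import Data.Empty using (⊥)
  open import Function using (case_of_)
  open import Relation.Nullary using (Dec; yes; no; ¬?)
  open import Relation.Nullary.Decidable using (from-yes; _⊎-dec_; _→-dec_)

  Is±3±7mod20 : ℕ → Set
  Is±3±7mod20 r = r ≡ 3 ⊎ r ≡ 7 ⊎ r ≡ 13 ⊎ r ≡ 17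

  is±3±7mod20? : ∀ r → Dec (Is±3±7mod20 r)
  is±3±7mod20? r = (r ≟ 3) ⊎-dec (r ≟ 7) ⊎-dec (r ≟ 13) ⊎-dec (r ≟ 17)

  module _ {n : ℕ} .{{_ : NonZero n}} where

    %-cong-+ : ∀ {a b c d} → a % n ≡ b % n → c % n ≡ d % n → (a + c) % n ≡ (b + d) % n
    %-cong-+ {a} {b} {c} {d} a≡b c≡d = begin
      (a + c) % n             ≡⟨ %-distribˡ-+ a c n ⟩
      (a % n + c % n) % n     ≡⟨ cong₂ (λ x y → (x + y) % n) a≡b c≡d ⟩
      (b % n + d % n) % n     ≡⟨ %-distribˡ-+ b d n ⟨
      (b + d) % n             ∎
      where open ≡-Reasoning

    %-cong-* : ∀ {a b c d} → a % n ≡ b % n → c % n ≡ d % n → (a * c) % n ≡ (b * d) % n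
    %-cong-* {a} {b} {c} {d} a≡b c≡d = begin
      (a * c) % n             ≡⟨ %-distribˡ-* a c n ⟩
      (a % n * (c % n)) % n   ≡⟨ cong₂ (λ x y → (x * y) % n) a≡b c≡d ⟩
      (b % n * (d % n)) % n   ≡⟨ %-distribˡ-* b d n ⟨
      (b * d) % n             ∎
      where open ≡-Reasoning

  SolvableMod : (n : ℕ) .{{_ : NonZero n}} → ℕ → ℕ → Set
  SolvableMod n m r = ∃ λ a → a < n × ∃ λ b → b < n × (b * b + m * r) % n ≡ (5 * (a * a)) % n

  solvableMod? : (n : ℕ) .{{_ : NonZero n}} → ∀ m r → Dec (SolvableMod n m r)
  solvableMod? n m r = anyUpTo? (λ a → anyUpTo? (λ b → (b * b + m * r) % n ≟ (5 * (a * a)) % n) n) n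

  solvableMod : (n : ℕ) .{{_ : NonZero n}} → ∀ {A B m r} → B * B + m * r ≡ 5 * (A * A) → SolvableMod n m (r % n)
  solvableMod n {A} {B} {m} {r} eq = A % n , m%n<n A n , B % n , m%n<n B n , (begin
    (B % n * (B % n) + m * (r % n)) % n ≡⟨ %-cong-+ (%-cong-* mod mod) (%-cong-* {a = m} refl mod) ⟩
    (B * B + m * r) % n                 ≡⟨ cong (_% n) eq ⟩
    (5 * (A * A)) % n                   ≡⟨ %-cong-* {a = 5} refl (%-cong-* mod mod) ⟨
    (5 * (A % n * (A % n))) % n         ∎)
    where
    open ≡-Reasoning
    mod : ∀ {x} → x % n % n ≡ x % n
    mod {x} = m%n%n≡m%n x n

  only-0-or-3-mod20 : ∀ {r} → r < 20 → Is±3±7mod20 r →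
    ∀ {m} → m < 5 → SolvableMod 20 m r → m ≡ 0 ⊎ m ≡ 3
  only-0-or-3-mod20 = from-yes (allUpTo? (λ r → is±3±7mod20? r →-dec
    allUpTo? (λ m → solvableMod? 20 m r →-dec ((m ≟ 0) ⊎-dec (m ≟ 3))) 5) 20)

  only-multiples-of-3-mod9 : ∀ {r} → r < 9 → SolvableMod 9 3 r → r % 3 ≡ 0
  only-multiples-of-3-mod9 = from-yes (allUpTo? (λ r → solvableMod? 9 3 r →-dec (r % 3 ≟ 0)) 9)

  prime[5] : Prime 5
  prime[5] = from-yes (prime? 5)

  5∣m*m⇒5∣m : ∀ m → 5 ∣ m * m → 5 ∣ m
  5∣m*m⇒5∣m m 5∣m*m = reduce (euclidsLemma m m prime[5] 5∣m*m)

  private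
    5*m*m≡[n*5]*[n*5]⇒m*m≡5*n*n : ∀ m n → 5 * (m * m) ≡ (n * 5) * (n * 5) → m * m ≡ 5 * (n * n)
    5*m*m≡[n*5]*[n*5]⇒m*m≡5*n*n m n eq = *-cancelˡ-≡ (m * m) (5 * (n * n)) 5 (trans eq (square n))
      where
      square : ∀ n → (n * 5) * (n * 5) ≡ 5 * (5 * (n * n))
      square = solve-∀

  5*m*m≡n*n⇒m≡0 : ∀ m n → 5 * (m * m) ≡ n * n → m ≡ 0
  5*m*m≡n*n⇒m≡0 m = descent m (<-wellFounded m)
    where
    descent : ∀ m → Acc _<_ m → ∀ n → 5 * (m * m) ≡ n * n → m ≡ 0
    descent′ : ∀ m → WfRec _<_ (Acc _<_) m → ∀ n → m * m ≡ 5 * (n * n) → m ≡ 0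

    descent m (acc smaller) n eq with 5∣m*m⇒5∣m n (divides (m * m) (trans (sym eq) (*-comm 5 (m * m))))
    ... | divides q refl = descent′ m smaller q (5*m*m≡[n*5]*[n*5]⇒m*m≡5*n*n m q eq)

    descent′ m smaller n eq with 5∣m*m⇒5∣m m (divides (n * n) (trans eq (*-comm 5 (n * n))))
    ... | divides zero refl = refl
    ... | divides r@(suc _) refl = cong (_* 5) (descent r (smaller (m<m*n r 5 (s≤s (s≤s z≤n)))) n
            (sym (5*m*m≡[n*5]*[n*5]⇒m*m≡5*n*n n r (sym eq))))

  s*s<3⇒s≤1 : ∀ s → s * s < 3 → s ≤ 1
  s*s<3⇒s≤1 zero _ = z≤n
  s*s<3⇒s≤1 (suc zero) _ = ≤-refl
  s*s<3⇒s≤1 s@(suc (suc _)) s*s<3 = contradiction (*-mono-≤ 2≤s 2≤s) (<⇒≱ (≤-trans s*s<3 (n≤1+n 3)))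
    where
    2≤s : 2 ≤ s
    2≤s = s≤s (s≤s z≤n)

  module _ {p s : ℕ} (p-prime : Prime p) (p%20 : Is±3±7mod20 (p % 20)) (s*s<p : s * s < p) where

    private
      instance
        p≢0 : NonZero p
        p≢0 = prime⇒nonZero p-prime

      p≡3 : ∀ A B → B * B + 3 * p ≡ 5 * (A * A) → p ≡ 3
      p≡3 A B eq = [ (λ ()) , sym ]′ (prime⇒irreducible p-prime (m%n≡0⇒n∣m p 3 p%3≡0))
        where
        p%3≡0 : p % 3 ≡ 0
        p%3≡0 = trans (sym (m∣n⇒o%n%m≡o%m 3 9 p (divides 3 refl)))
                      (only-multiples-of-3-mod9 (m%n<n p 9) (solvableMod 9 {A} {B} {3} {p} eq))

      square+3p≢5*square : ∀ A B → A ≤ s → B * B + 3 * p ≢ 5 * (A * A)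
      square+3p≢5*square A B A≤s eq =
        at-3 (p≡3 A B eq) (≤-trans A≤s (s*s<3⇒s≤1 s (subst (s * s <_) (p≡3 A B eq) s*s<p)))
        where
        at-3 : p ≡ 3 → A ≤ 1 → ⊥
        at-3 refl z≤n = case trans (+-comm 9 (B * B)) eq of λ ()
        at-3 refl (s≤s z≤n) = case trans (+-comm 9 (B * B)) eq of λ ()

    square+multiple≢5*square : ∀ A B m → A ≤ s → B ≤ s → B * B + suc m * p ≢ 5 * (A * A)
    square+multiple≢5*square A B m A≤s B≤s eq =
      case only-0-or-3-mod20 (m%n<n p 20) p%20 1+m<5 (solvableMod 20 {A} {B} {suc m} {p} eq) of λ where
        (inj₁ ())
        (inj₂ refl) → square+3p≢5*square A B A≤s eq
      where
      1+m<5 : suc m < 5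
      1+m<5 = *-cancelʳ-< p (suc m) 5 (begin-strict
        suc m * p          ≤⟨ m≤n+m (suc m * p) (B * B) ⟩
        B * B + suc m * p  ≡⟨ eq ⟩
        5 * (A * A)        ≤⟨ *-monoʳ-≤ 5 (*-mono-≤ A≤s A≤s) ⟩
        5 * (s * s)        <⟨ *-monoʳ-< 5 s*s<p ⟩
        5 * p              ∎)
        where open ≤-Reasoning

  ⌊√⌋-exists : ∀ n → ∃ λ s → s * s ≤ n × n < suc s * suc s
  ⌊√⌋-exists zero = 0 , z≤n , s≤s z≤n
  ⌊√⌋-exists (suc n) with ⌊√⌋-exists n
  ... | s , s*s≤n , n<[1+s]² with suc n <? suc s * suc s
  ...   | yes 1+n<[1+s]² = s , m≤n⇒m≤1+n s*s≤n , 1+n<[1+s]²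
  ...   | no  1+n≮[1+s]² = suc s , ≮⇒≥ 1+n≮[1+s]² , ≤-<-trans n<[1+s]² (*-mono-< (n<1+n (suc s)) (n<1+n (suc s)))

  m*m≢prime : ∀ {p} → Prime p → ∀ m → m * m ≢ p
  m*m≢prime {p} p-prime m m*m≡p with prime⇒irreducible p-prime (divides m (sym m*m≡p))
  ... | inj₁ refl = ¬prime[1] (subst Prime (sym m*m≡p) p-prime)
  ... | inj₂ refl = ¬prime[1] (subst Prime (*-cancelˡ-≡ m 1 m (trans m*m≡p (sym (*-identityʳ m)))) p-prime)
    where
    instance
      p≢0 : NonZero p
      p≢0 = prime⇒nonZero p-prime

  is±3±7mod20⇒∤4 : ∀ {p} → Is±3±7mod20 (p % 20) → ¬ p ∣ 4
  is±3±7mod20⇒∤4 {p} p%20 p∣4 = small-cases (s≤s (∣⇒≤ p∣4)) p∣4 p%20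
    where
    small-cases : ∀ {p} → p < 5 → p ∣ 4 → ¬ Is±3±7mod20 (p % 20)
    small-cases = from-yes (allUpTo? (λ p → (p ∣? 4) →-dec ¬? (is±3±7mod20? (p % 20))) 5)

open OverNaturals

import Data.Nat.Properties as ℕ
import Data.Nat.GCD as ℕ
import Data.Nat.Divisibility as ℕD
open import Data.Nat.DivMod using (m≡m%n+[m/n]*n)
open import Data.Integer using (ℤ; +_; -[1+_]; _+_; _-_; _*_; -_; ∣_∣; 0ℤ; 1ℤ)
import Data.Integer.Properties as ℤ
open import Data.Integer.DivMod using (_%ℕ_; _/ℕ_; n%ℕd<d; a≡a%ℕn+[a/ℕn]*n)
open import Data.Integer.GCD using (gcd)
import Data.Integer.Divisibility as Unsigned
open import Data.Integer.Divisibility.Signed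
  using (_∣_; divides; ∣ᵤ⇒∣; ∣⇒∣ᵤ; ∣n⇒∣m*n; ∣m⇒∣m*n; ∣m∣n⇒∣m+n; ∣m∣n⇒∣m-n)
open import Data.Integer.Tactic.RingSolver using (solve-∀)
open import Data.Fin as Fin using (Fin; toℕ; fromℕ<; remQuot; combine)
open import Data.Fin.Properties using (pigeonhole; toℕ-fromℕ<; toℕ-injective; toℕ<n; combine-remQuot; <-irrefl)
open import Data.Empty using (⊥-elim)
open import Function using (_∘_)

-- 5 is not a square modulo a prime p ≡ ±3, ±7 (mod 20)

private
  remainder-difference : ∀ r x y q → (r + x * q) - (r + y * q) ≡ (x - y) * q
  remainder-difference = solve-∀

  pair-difference : ∀ i i′ j j′ y z → (i * z - j * y) - (i′ * z - j′ * y) ≡ (i - i′) * z - (j - j′) * y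
  pair-difference = solve-∀

%ℕ-≡⇒∣- : ∀ {p} .{{_ : NonZero p}} {i j} → i %ℕ p ≡ j %ℕ p → + p ∣ i - j
%ℕ-≡⇒∣- {p} {i} {j} eq = divides (i /ℕ p - j /ℕ p) (begin
  i - j
    ≡⟨ cong₂ _-_ (a≡a%ℕn+[a/ℕn]*n i p) (a≡a%ℕn+[a/ℕn]*n j p) ⟩
  (+ (i %ℕ p) + (i /ℕ p) * + p) - (+ (j %ℕ p) + (j /ℕ p) * + p)
    ≡⟨ cong (λ r → (+ (i %ℕ p) + (i /ℕ p) * + p) - (+ r + (j /ℕ p) * + p)) eq ⟨
  (+ (i %ℕ p) + (i /ℕ p) * + p) - (+ (i %ℕ p) + (j /ℕ p) * + p)
    ≡⟨ remainder-difference (+ (i %ℕ p)) (i /ℕ p) (j /ℕ p) (+ p) ⟩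
  (i /ℕ p - j /ℕ p) * + p ∎)
  where open ≡-Reasoning

∣+m-+n∣≤ : ∀ {m n s} → m ≤ s → n ≤ s → ∣ + m - + n ∣ ≤ s
∣+m-+n∣≤ {m} {n} m≤s n≤s =
  subst (_≤ _) (cong ∣_∣ (sym (ℤ.m-n≡m⊖n m n))) (ℕ.≤-trans (ℤ.∣m⊝n∣≤m⊔n m n) (ℕ.⊔-lub m≤s n≤s))

remQuot-injective : ∀ {m} n {x y : Fin (m ℕ.* n)} → remQuot {m} n x ≡ remQuot n y → x ≡ y
remQuot-injective {m} n {x} {y} eq =
  trans (sym (combine-remQuot {m} n x)) (trans (cong (uncurry combine) eq) (combine-remQuot {m} n y))

-- Thue's lemma, by pigeonhole on the (s+1)² values i z - j y with 0 ≤ i, j ≤ s.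
thue : ∀ {p s} .{{_ : NonZero p}} → p < suc s ℕ.* suc s → ∀ y z →
  ∃₂ λ a b → ∣ a ∣ ≤ s × ∣ b ∣ ≤ s × ¬ (a ≡ 0ℤ × b ≡ 0ℤ) × + p ∣ a * z - b * y
thue {p} {s} p<[1+s]² y z = collision (pigeonhole p<[1+s]² residue)
  where
  Pair : Set
  Pair = Fin (suc s ℕ.* suc s)

  i j : Pair → ℕ
  i x = toℕ (proj₁ (remQuot {suc s} (suc s) x))
  j x = toℕ (proj₂ (remQuot {suc s} (suc s) x))

  i≤s : ∀ x → i x ≤ s
  i≤s x = ℕ.≤-pred (toℕ<n (proj₁ (remQuot {suc s} (suc s) x)))
  j≤s : ∀ x → j x ≤ s
  j≤s x = ℕ.≤-pred (toℕ<n (proj₂ (remQuot {suc s} (suc s) x)))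

  value : Pair → ℤ
  value x = + i x * z - + j x * y

  residue : Pair → Fin p
  residue x = fromℕ< (n%ℕd<d (value x) p)

  ≡-from-coordinates : ∀ {x x′} → + i x - + i x′ ≡ 0ℤ → + j x - + j x′ ≡ 0ℤ → x ≡ x′
  ≡-from-coordinates {x} {x′} a≡0 b≡0 = remQuot-injective (suc s) (cong₂ _,_ (coordinate a≡0) (coordinate b≡0))
    where
    coordinate : ∀ {n} {u v : Fin n} → + toℕ u - + toℕ v ≡ 0ℤ → u ≡ v
    coordinate {u = u} {v} eq = toℕ-injective (ℤ.+-injective (ℤ.i-j≡0⇒i≡j (+ toℕ u) (+ toℕ v) eq))

  collision : ∃₂ (λ x x′ → x Fin.< x′ × residue x ≡ residue x′) →
    ∃₂ λ a b → ∣ a ∣ ≤ s × ∣ b ∣ ≤ s × ¬ (a ≡ 0ℤ × b ≡ 0ℤ) × + p ∣ a * z - b * y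
  collision (x , x′ , x<x′ , same) =
      + i x - + i x′ , + j x - + j x′
    , ∣+m-+n∣≤ (i≤s x) (i≤s x′) , ∣+m-+n∣≤ (j≤s x) (j≤s x′)
    , (λ (a≡0 , b≡0) → <-irrefl (≡-from-coordinates a≡0 b≡0) x<x′)
    , subst (+ p ∣_) (pair-difference (+ i x) (+ i x′) (+ j x) (+ j x′) y z)
            (%ℕ-≡⇒∣- {i = value x} {value x′}
              (trans (sym (toℕ-fromℕ< _)) (trans (cong toℕ same) (toℕ-fromℕ< _))))

private
  x≡y+[x-y] : ∀ x y → x ≡ y + (x - y)
  x≡y+[x-y] = solve-∀

  y≡[y-n*q]+n*q : ∀ y n q → y ≡ (y + - n * q) + n * q
  y≡[y-n*q]+n*q = solve-∀

  recombine : ∀ a b y z →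
    y * y * (+ 5 * (a * a) - b * b) ≡ a * a * (+ 5 * (y * y) - z * z) + (a * z - b * y) * (a * z + b * y)
  recombine = solve-∀

i*i≡+∣i∣*∣i∣ : ∀ i → i * i ≡ + (∣ i ∣ ℕ.* ∣ i ∣)
i*i≡+∣i∣*∣i∣ (+ n) = sym (ℤ.pos-* n n)
i*i≡+∣i∣*∣i∣ -[1+ n ] = refl

+m≡+n++o*+q⇒m≡n+o*q : ∀ {m} n o q → + m ≡ + n + + o * + q → m ≡ n ℕ.+ o ℕ.* q
+m≡+n++o*+q⇒m≡n+o*q n o q eq =
  ℤ.+-injective (trans eq (trans (cong (_+_ (+ n)) (sym (ℤ.pos-* o q))) (sym (ℤ.pos-+ n (o ℕ.* q)))))

euclidsLemma-ℤ : ∀ {p} → Prime p → ∀ i j → (+ p) ∣ i * j → ((+ p) ∣ i) ⊎ ((+ p) ∣ j)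
euclidsLemma-ℤ {p} p-prime i j p∣ij
  with euclidsLemma ∣ i ∣ ∣ j ∣ p-prime (subst (ℕD._∣_ p) (ℤ.abs-* i j) (∣⇒∣ᵤ p∣ij))
... | inj₁ p∣i = inj₁ (∣ᵤ⇒∣ p∣i)
... | inj₂ p∣j = inj₂ (∣ᵤ⇒∣ p∣j)

module _ {p s : ℕ} (p-prime : Prime p) (p%20 : Is±3±7mod20 (p % 20)) (s*s<p : s ℕ.* s < p) where

  p∣5a²-b²⇒a≡b≡0 : ∀ {a b} → ∣ a ∣ ≤ s → ∣ b ∣ ≤ s →
    (+ p) ∣ + 5 * (a * a) - b * b → a ≡ 0ℤ × b ≡ 0ℤ
  p∣5a²-b²⇒a≡b≡0 {a} {b} A≤s B≤s (divides q eq) = by-quotient q eq′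
    where
    A B : ℕ
    A = ∣ a ∣
    B = ∣ b ∣
    eq′ : + (5 ℕ.* (A ℕ.* A)) ≡ + (B ℕ.* B) + q * + p
    eq′ = trans (ℤ.pos-* 5 (A ℕ.* A)) (trans (cong (+ 5 *_) (sym (i*i≡+∣i∣*∣i∣ a)))
         (trans (x≡y+[x-y] (+ 5 * (a * a)) (b * b))
                (cong₂ _+_ (i*i≡+∣i∣*∣i∣ b) eq)))
    by-quotient : ∀ q → + (5 ℕ.* (A ℕ.* A)) ≡ + (B ℕ.* B) + q * + p → a ≡ 0ℤ × b ≡ 0ℤ
    by-quotient (+ zero) e = ℤ.∣i∣≡0⇒i≡0 A≡0 , ℤ.∣i∣≡0⇒i≡0 (reduce (ℕ.m*n≡0⇒m≡0∨n≡0 B B*B≡0))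
      where
      5A²≡B² : 5 ℕ.* (A ℕ.* A) ≡ B ℕ.* B
      5A²≡B² = trans (+m≡+n++o*+q⇒m≡n+o*q (B ℕ.* B) 0 p e) (ℕ.+-identityʳ (B ℕ.* B))
      A≡0 : A ≡ 0
      A≡0 = 5*m*m≡n*n⇒m≡0 A B 5A²≡B²
      B*B≡0 : B ℕ.* B ≡ 0
      B*B≡0 = trans (sym 5A²≡B²) (cong (λ x → 5 ℕ.* (x ℕ.* x)) A≡0)
    by-quotient (+ suc m) e = ⊥-elim (square+multiple≢5*square p-prime p%20 s*s<p A B m A≤s B≤s
                                       (sym (+m≡+n++o*+q⇒m≡n+o*q (B ℕ.* B) (suc m) p e)))
    by-quotient -[1+ m ] e = ⊥-elim (ℕ.<⇒≱ s*s<p (begin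
      p                                    ≤⟨ ℕ.m≤n*m p (suc m) ⟩
      suc m ℕ.* p                          ≤⟨ ℕ.m≤n+m (suc m ℕ.* p) (5 ℕ.* (A ℕ.* A)) ⟩
      5 ℕ.* (A ℕ.* A) ℕ.+ suc m ℕ.* p
                                           ≡⟨ +m≡+n++o*+q⇒m≡n+o*q (5 ℕ.* (A ℕ.* A)) (suc m) p B²≡5A²+[1+m]p ⟨
      B ℕ.* B                              ≤⟨ ℕ.*-mono-≤ B≤s B≤s ⟩
      s ℕ.* s                              ∎))
      where
      open ℕ.≤-Reasoning
      B²≡5A²+[1+m]p : + (B ℕ.* B) ≡ + (5 ℕ.* (A ℕ.* A)) + + suc m * + p
      B²≡5A²+[1+m]p = trans (y≡[y-n*q]+n*q (+ (B ℕ.* B)) (+ suc m) (+ p)) (cong (_+ + suc m * + p) (sym e))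

5-nonresidue : ∀ {p} → Prime p → Is±3±7mod20 (p % 20) → ∀ y z → (+ p) ∣ + 5 * (y * y) - z * z → (+ p) ∣ y
5-nonresidue {p} p-prime p%20 y z p∣5y²-z² = from-thue (thue p<[1+s]² y z)
  where
  instance
    p≢0 : NonZero p
    p≢0 = prime⇒nonZero p-prime
  s : ℕ
  s = proj₁ (⌊√⌋-exists p)
  p<[1+s]² : p < suc s ℕ.* suc s
  p<[1+s]² = proj₂ (proj₂ (⌊√⌋-exists p))
  s*s<p : s ℕ.* s < p
  s*s<p = ℕ.≤∧≢⇒< (proj₁ (proj₂ (⌊√⌋-exists p))) (m*m≢prime p-prime s)

  from-thue : ∃₂ (λ a b → ∣ a ∣ ≤ s × ∣ b ∣ ≤ s × ¬ (a ≡ 0ℤ × b ≡ 0ℤ) × (+ p) ∣ a * z - b * y) →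
    (+ p) ∣ y
  from-thue (a , b , a≤s , b≤s , nontrivial , p∣az-by) =
    [ (λ p∣y² → reduce (euclidsLemma-ℤ p-prime y y p∣y²))
    , (λ p∣5a²-b² → ⊥-elim (nontrivial (p∣5a²-b²⇒a≡b≡0 p-prime p%20 s*s<p a≤s b≤s p∣5a²-b²)))
    ]′ (euclidsLemma-ℤ p-prime (y * y) (+ 5 * (a * a) - b * b) p∣y²[5a²-b²])
    where
    p∣y²[5a²-b²] : (+ p) ∣ y * y * (+ 5 * (a * a) - b * b)
    p∣y²[5a²-b²] = subst ((+ p) ∣_) (sym (recombine a b y z))
      (∣m∣n⇒∣m+n (∣n⇒∣m*n (a * a) p∣5y²-z²) (∣m⇒∣m*n (a * z + b * y) p∣az-by))

-- Window sums of Fibonacci-like sequences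

open ≡-Reasoning

fib : ℕ → ℤ
fib 0 = 0ℤ
fib 1 = 1ℤ
fib (suc (suc n)) = fib (suc n) + fib n

-- L_k = F_{k-1} + F_{k+1}, written without F_{-1}.
lucas : ℕ → ℤ
lucas k = + 2 * fib (suc k) - fib k

IsFibonacciLike : (ℕ → ℤ) → Set
IsFibonacciLike G = ∀ n → G (suc (suc n)) ≡ G (suc n) + G n

private
  expansion-base₀ : ∀ x y → y ≡ 0ℤ * x + 1ℤ * y
  expansion-base₀ = solve-∀

  expansion-base₁ : ∀ x y → y + x ≡ 1ℤ * x + 1ℤ * y
  expansion-base₁ = solve-∀

  expansion-step : ∀ f₀ f₁ x y →
    (f₁ * x + (f₁ + f₀) * y) + (f₀ * x + f₁ * y) ≡ (f₁ + f₀) * x + ((f₁ + f₀) + f₁) * y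
  expansion-step = solve-∀

  telescope-step : ∀ g₀ g₁ w → (g₀ + w) + g₁ ≡ w + (g₁ + g₀)
  telescope-step = solve-∀

  x≡[x+y]-y : ∀ x y → x ≡ (x + y) - y
  x≡[x+y]-y = solve-∀

  expansion-difference : ∀ a b c d x y → (c * x + d * y) - (a * x + b * y) ≡ (c - a) * x + (d - b) * y
  expansion-difference = solve-∀

module _ {G : ℕ → ℤ} (fibLike : IsFibonacciLike G) where

  fibonacciLike-expansion : ∀ n → G (suc n) ≡ fib n * G 0 + fib (suc n) * G 1
  fibonacciLike-expansion zero = expansion-base₀ (G 0) (G 1)
  fibonacciLike-expansion (suc zero) = trans (fibLike 0) (expansion-base₁ (G 0) (G 1))
  fibonacciLike-expansion (suc (suc n)) = begin
    G (3 ℕ.+ n)                  ≡⟨ fibLike (suc n) ⟩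
    G (2 ℕ.+ n) + G (suc n)      ≡⟨ cong₂ _+_ (fibonacciLike-expansion (suc n)) (fibonacciLike-expansion n) ⟩
    (fib (suc n) * G 0 + fib (2 ℕ.+ n) * G 1) + (fib n * G 0 + fib (suc n) * G 1)
                                 ≡⟨ expansion-step (fib n) (fib (suc n)) (G 0) (G 1) ⟩
    fib (2 ℕ.+ n) * G 0 + fib (3 ℕ.+ n) * G 1 ∎

  windowSum-telescope : ∀ n k → windowSum G n k + G (suc n) ≡ G (suc (n ℕ.+ k))
  windowSum-telescope n zero = trans (ℤ.+-identityˡ (G (suc n))) (cong (G ∘ suc) (sym (ℕ.+-identityʳ n)))
  windowSum-telescope n (suc k) = begin
    (G n + windowSum G (suc n) k) + G (suc n) ≡⟨ telescope-step (G n) (G (suc n)) (windowSum G (suc n) k) ⟩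
    windowSum G (suc n) k + (G (suc n) + G n) ≡⟨ cong (λ g → windowSum G (suc n) k + g) (sym (fibLike n)) ⟩
    windowSum G (suc n) k + G (2 ℕ.+ n)       ≡⟨ windowSum-telescope (suc n) k ⟩
    G (2 ℕ.+ (n ℕ.+ k))                       ≡⟨ cong (G ∘ suc) (sym (ℕ.+-suc n k)) ⟩
    G (suc (n ℕ.+ suc k)) ∎

  windowSum-expansion : ∀ n k →
    windowSum G (suc n) k ≡ (fib (suc n ℕ.+ k) - fib (suc n)) * G 0 + (fib (2 ℕ.+ n ℕ.+ k) - fib (2 ℕ.+ n)) * G 1
  windowSum-expansion n k = begin
    windowSum G (suc n) k                        ≡⟨ x≡[x+y]-y _ (G (2 ℕ.+ n)) ⟩
    (windowSum G (suc n) k + G (2 ℕ.+ n)) - G (2 ℕ.+ n)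
                                                 ≡⟨ cong (_- G (2 ℕ.+ n)) (windowSum-telescope (suc n) k) ⟩
    G (2 ℕ.+ n ℕ.+ k) - G (2 ℕ.+ n)
        ≡⟨ cong₂ _-_ (fibonacciLike-expansion (suc n ℕ.+ k)) (fibonacciLike-expansion (suc n)) ⟩
    (fib (suc n ℕ.+ k) * G 0 + fib (2 ℕ.+ n ℕ.+ k) * G 1) - (fib (suc n) * G 0 + fib (2 ℕ.+ n) * G 1)
        ≡⟨ expansion-difference (fib (suc n)) (fib (2 ℕ.+ n)) (fib (suc n ℕ.+ k)) (fib (2 ℕ.+ n ℕ.+ k))
                                (G 0) (G 1) ⟩
    (fib (suc n ℕ.+ k) - fib (suc n)) * G 0 + (fib (2 ℕ.+ n ℕ.+ k) - fib (2 ℕ.+ n)) * G 1 ∎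

cassini : ℕ → ℤ
cassini k = fib k * fib (2 ℕ.+ k) - fib (suc k) * fib (suc k)

private
  cassini-step : ∀ f₀ f₁ → f₁ * ((f₁ + f₀) + f₁) - (f₁ + f₀) * (f₁ + f₀) ≡ - (f₀ * (f₁ + f₀) - f₁ * f₁)
  cassini-step = solve-∀

  lucas-square : ∀ f₀ f₁ →
    (+ 2 * f₁ - f₀) * (+ 2 * f₁ - f₀) - + 5 * (f₀ * f₀) ≡ - (+ 4 * (f₀ * (f₁ + f₀) - f₁ * f₁))
  lucas-square = solve-∀

  determinant : ∀ f₀ f₁ → ((f₁ + f₀) - 1ℤ) * ((f₁ + f₀) - 1ℤ) - (f₁ - 1ℤ) * (((f₁ + f₀) + f₁) - + 2)
                        ≡ (f₀ * (f₁ + f₀) - f₁ * f₁) + (+ 2 * f₁ - f₀) - 1ℤ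
  determinant = solve-∀

  adjugate₀ : ∀ u v w t x y → v * (w * x + t * y) - t * (u * x + v * y) ≡ (v * w - u * t) * x
  adjugate₀ = solve-∀

  adjugate₁ : ∀ u v w t x y → w * (u * x + v * y) - u * (w * x + t * y) ≡ (v * w - u * t) * y
  adjugate₁ = solve-∀

cassini-suc : ∀ k → cassini (suc k) ≡ - cassini k
cassini-suc k = cassini-step (fib k) (fib (suc k))

cassini-odd : ∀ k → k % 2 ≡ 1 → cassini k ≡ 1ℤ
cassini-odd k k%2≡1 = subst (λ n → cassini n ≡ 1ℤ) (sym k≡1+2m) (at-odd (k / 2))
  where
  k≡1+2m : k ≡ suc (k / 2 ℕ.* 2)
  k≡1+2m = trans (m≡m%n+[m/n]*n k 2) (cong (ℕ._+ k / 2 ℕ.* 2) k%2≡1)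
  at-odd : ∀ m → cassini (suc (m ℕ.* 2)) ≡ 1ℤ
  at-odd zero = refl
  at-odd (suc m) = begin
    cassini (3 ℕ.+ m ℕ.* 2)      ≡⟨ cassini-suc (2 ℕ.+ m ℕ.* 2) ⟩
    - cassini (2 ℕ.+ m ℕ.* 2)    ≡⟨ cong -_ (cassini-suc (suc (m ℕ.* 2))) ⟩
    - - cassini (suc (m ℕ.* 2))  ≡⟨ ℤ.neg-involutive _ ⟩
    cassini (suc (m ℕ.* 2))      ≡⟨ at-odd m ⟩
    1ℤ                           ∎

lucas²-5fib²-odd : ∀ k → k % 2 ≡ 1 → lucas k * lucas k - + 5 * (fib k * fib k) ≡ - + 4
lucas²-5fib²-odd k k%2≡1 = begin
  lucas k * lucas k - + 5 * (fib k * fib k) ≡⟨ lucas-square (fib k) (fib (suc k)) ⟩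
  - (+ 4 * cassini k)                       ≡⟨ cong (λ c → - (+ 4 * c)) (cassini-odd k k%2≡1) ⟩
  - + 4                                     ∎

windowSum-determinant-odd : ∀ k → k % 2 ≡ 1 →
  (fib (2 ℕ.+ k) - fib 2) * (fib (2 ℕ.+ k) - fib 2) - (fib (suc k) - fib 1) * (fib (3 ℕ.+ k) - fib 3) ≡ lucas k
windowSum-determinant-odd k k%2≡1 = begin
  (fib (2 ℕ.+ k) - fib 2) * (fib (2 ℕ.+ k) - fib 2) - (fib (suc k) - fib 1) * (fib (3 ℕ.+ k) - fib 3)
                                   ≡⟨ determinant (fib k) (fib (suc k)) ⟩
  cassini k + lucas k - 1ℤ         ≡⟨ cong (λ c → c + lucas k - 1ℤ) (cassini-odd k k%2≡1) ⟩
  1ℤ + lucas k - 1ℤ                ≡⟨ cancel-1 (lucas k) ⟩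
  lucas k                          ∎
  where
  cancel-1 : ∀ l → 1ℤ + l - 1ℤ ≡ l
  cancel-1 = solve-∀

module _ {G : ℕ → ℤ} (fibLike : IsFibonacciLike G) {k : ℕ} (k%2≡1 : k % 2 ≡ 1) {c : ℤ}
         (c∣S₁ : c ∣ windowSum G 1 k) (c∣S₂ : c ∣ windowSum G 2 k) where

  private
    u v t : ℤ
    u = fib (suc k) - fib 1
    v = fib (2 ℕ.+ k) - fib 2
    t = fib (3 ℕ.+ k) - fib 3

    S₁≡ : windowSum G 1 k ≡ u * G 0 + v * G 1
    S₁≡ = windowSum-expansion fibLike 0 k

    S₂≡ : windowSum G 2 k ≡ v * G 0 + t * G 1
    S₂≡ = windowSum-expansion fibLike 1 k

    det≡lucas : v * v - u * t ≡ lucas k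
    det≡lucas = windowSum-determinant-odd k k%2≡1

  windowSum-divisor∣lucas*G₀ : c ∣ lucas k * G 0
  windowSum-divisor∣lucas*G₀ = subst (c ∣_) combination (∣m∣n⇒∣m-n (∣n⇒∣m*n v c∣S₂) (∣n⇒∣m*n t c∣S₁))
    where
    combination : v * windowSum G 2 k - t * windowSum G 1 k ≡ lucas k * G 0
    combination = begin
      v * windowSum G 2 k - t * windowSum G 1 k           ≡⟨ cong₂ (λ S₂ S₁ → v * S₂ - t * S₁) S₂≡ S₁≡ ⟩
      v * (v * G 0 + t * G 1) - t * (u * G 0 + v * G 1)   ≡⟨ adjugate₀ u v v t (G 0) (G 1) ⟩
      (v * v - u * t) * G 0                               ≡⟨ cong (_* G 0) det≡lucas ⟩
      lucas k * G 0                                       ∎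

  windowSum-divisor∣lucas*G₁ : c ∣ lucas k * G 1
  windowSum-divisor∣lucas*G₁ = subst (c ∣_) combination (∣m∣n⇒∣m-n (∣n⇒∣m*n v c∣S₁) (∣n⇒∣m*n u c∣S₂))
    where
    combination : v * windowSum G 1 k - u * windowSum G 2 k ≡ lucas k * G 1
    combination = begin
      v * windowSum G 1 k - u * windowSum G 2 k           ≡⟨ cong₂ (λ S₁ S₂ → v * S₁ - u * S₂) S₁≡ S₂≡ ⟩
      v * (u * G 0 + v * G 1) - u * (v * G 0 + t * G 1)   ≡⟨ adjugate₁ u v v t (G 0) (G 1) ⟩
      (v * v - u * t) * G 1                               ≡⟨ cong (_* G 1) det≡lucas ⟩
      lucas k * G 1                                       ∎

∣i*j∧∣i*k∧gcd[j,k]≡1⇒∣i : ∀ {c} i j k → gcd j k ≡ 1ℤ →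
  c Unsigned.∣ i * j → c Unsigned.∣ i * k → c Unsigned.∣ i
∣i*j∧∣i*k∧gcd[j,k]≡1⇒∣i {c} i j k gcd≡1 c∣ij c∣ik = subst (ℕD._∣_ ∣ c ∣) a*gcd[m,n]≡a
  (ℕ.gcd-greatest (subst (ℕD._∣_ ∣ c ∣) (ℤ.abs-* i j) c∣ij) (subst (ℕD._∣_ ∣ c ∣) (ℤ.abs-* i k) c∣ik))
  where
  a m n : ℕ
  a = ∣ i ∣
  m = ∣ j ∣
  n = ∣ k ∣
  a*gcd[m,n]≡a : ℕ.gcd (a ℕ.* m) (a ℕ.* n) ≡ a
  a*gcd[m,n]≡a = begin
    ℕ.gcd (a ℕ.* m) (a ℕ.* n) ≡⟨ ℕ.c*gcd[m,n]≡gcd[cm,cn] a m n ⟨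
    a ℕ.* ℕ.gcd m n           ≡⟨ cong (a ℕ.*_) (ℤ.+-injective gcd≡1) ⟩
    a ℕ.* 1                   ≡⟨ ℕ.*-identityʳ a ⟩
    a                         ∎

windowSumGCD∣lucas : ∀ {G} → IsFibonacciLike G → gcd (G 0) (G 1) ≡ 1ℤ →
  ∀ k → k % 2 ≡ 1 → ∀ {d} → IsWindowSumGCD G k d → (+ d) Unsigned.∣ lucas k
windowSumGCD∣lucas {G} fibLike gcd≡1 k k%2≡1 {d} (d∣windowSums , _) =
  ∣i*j∧∣i*k∧gcd[j,k]≡1⇒∣i {+ d} (lucas k) (G 0) (G 1) gcd≡1
    (∣⇒∣ᵤ (windowSum-divisor∣lucas*G₀ {G} fibLike {k} k%2≡1 d∣S₁ d∣S₂))
    (∣⇒∣ᵤ (windowSum-divisor∣lucas*G₁ {G} fibLike {k} k%2≡1 d∣S₁ d∣S₂))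
  where
  d∣S₁ : (+ d) ∣ windowSum G 1 k
  d∣S₁ = ∣ᵤ⇒∣ (d∣windowSums 1 (s≤s z≤n))
  d∣S₂ : (+ d) ∣ windowSum G 2 k
  d∣S₂ = ∣ᵤ⇒∣ (d∣windowSums 2 (s≤s z≤n))

prime∤lucas-odd : ∀ {p} → Prime p → Is±3±7mod20 (p % 20) → ∀ k → k % 2 ≡ 1 → ¬ (+ p) ∣ lucas k
prime∤lucas-odd {p} p-prime p%20 k k%2≡1 p∣L = is±3±7mod20⇒∤4 p%20 (∣⇒∣ᵤ p∣4)
  where
  L F : ℤ
  L = lucas k
  F = fib k

  5F²-2²≡L² : + 5 * (F * F) - + 2 * + 2 ≡ L * L
  5F²-2²≡L² = begin
    + 5 * (F * F) + - + 4                        ≡⟨ cong (λ x → + 5 * (F * F) + x) (lucas²-5fib²-odd k k%2≡1) ⟨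
    + 5 * (F * F) + (L * L - + 5 * (F * F))      ≡⟨ cancel (+ 5 * (F * F)) (L * L) ⟩
    L * L                                        ∎
    where
    cancel : ∀ x y → x + (y - x) ≡ y
    cancel = solve-∀

  5F²-L²≡4 : + 5 * (F * F) - L * L ≡ + 4
  5F²-L²≡4 = begin
    + 5 * (F * F) - L * L          ≡⟨ swap (L * L) (+ 5 * (F * F)) ⟩
    - (L * L - + 5 * (F * F))      ≡⟨ cong -_ (lucas²-5fib²-odd k k%2≡1) ⟩
    + 4                            ∎
    where
    swap : ∀ x y → y - x ≡ - (x - y)
    swap = solve-∀

  p∣F : (+ p) ∣ F
  p∣F = 5-nonresidue p-prime p%20 F (+ 2) (subst ((+ p) ∣_) (sym 5F²-2²≡L²) (∣m⇒∣m*n L p∣L))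

  p∣4 : (+ p) ∣ + 4
  p∣4 = subst ((+ p) ∣_) 5F²-L²≡4 (∣m∣n⇒∣m-n (∣n⇒∣m*n (+ 5) (∣m⇒∣m*n F p∣F)) (∣m⇒∣m*n L p∣L))

theorem6p5 : (G : ℕ → ℤ) → gcd (G 0) (G 1) ≡ + 1 →
    (∀ n → G (suc (suc n)) ≡ G (suc n) + G n) →
    (k : ℕ) → k % 2 ≡ 1 →
    (d : ℕ) → IsWindowSumGCD G k d →
    (p : ℕ) → Prime p →
    (p % 20 ≡ 3 ⊎ p % 20 ≡ 7 ⊎ p % 20 ≡ 13 ⊎ p % 20 ≡ 17) →
    ¬ (p ℕD.∣ d)
theorem6p5 G gcd≡1 fibLike k k%2≡1 d isGCD p p-prime p%20 p∣d =
  prime∤lucas-odd p-prime p%20 k k%2≡1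
    (∣ᵤ⇒∣ (ℕD.∣-trans p∣d (windowSumGCD∣lucas {G} fibLike gcd≡1 k k%2≡1 isGCD)))
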